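{- Let $U$ be the set of positive roots of $8$-height $1$ in the root system $\Phi$ of type $E_8$, let $\eta=\theta-\alpha_8$, and let $Q\in\Omega_U$ with $\eta\in Q$. (i) $\alpha_8\notin\mathrm{Res}_U(Q)$. (ii) Every element of $\mathrm{Res}_U(Q)$ is orthogonal to $\eta$.
   Context: $\Phi$ is the root system of type $E_8$ with simple roots $\alpha_1,\dots,\alpha_8$ labelled so that $\alpha_1,\alpha_3,\alpha_4,\dots,\alpha_8$ form a path in this order and $\alpha_2$ is joined only to $\alpha_4$; invariant form $B$ (orthogonal means $B=0$); $s_\beta(\gamma)=\gamma-B(\beta,\gamma)\beta$; the $8$-height of a root is its $\alpha_8$-coefficient; $\theta=2\alpha_1+3\alpha_2+4\alpha_3+6\alpha_4+5\alpha_5+4\alpha_6+3\alpha_7+2\alpha_8$ is the highest root. $\Omega_U$ is the set of pairwise orthogonal subsets of $U$ of maximal cardinality; $\mathrm{Res}_U(Q)=\{\gamma\in U:s_\beta(\gamma)\in\Phi_+\ \forall\beta\in Q\}$. -}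

module Defs where

open import Data.Nat using (ℕ; _≤_)
open import Data.Integer using (ℤ; +_; -_; _+_; _-_; _*_) renaming (_≤_ to _≤ℤ_)
open import Data.Fin using (Fin; zero; suc)
open import Data.Vec using (Vec; []; _∷_; lookup; zipWith; map; tabulate; foldr)
open import Data.Vec.Relation.Unary.All using (All)
open import Data.List using (List; length)
open import Data.List.Relation.Unary.Unique.Propositional using (Unique)
open import Data.List.Membership.Propositional using (_∈_)
open import Relation.Binary.PropositionalEquality using (_≡_; _≢_)
open import Data.Product using (_×_)

-- Elements of the root lattice of E8, written in the basis of simple
-- roots: v = Σ_i (lookup v i) α_{i+1}  (index 0 ↦ α₁, …, index 7 ↦ α₈).
Vect : Set
Vect = Vec ℤ 8

-- Cartan matrix of E8, Bourbaki labelling: edges 1-3, 3-4, 4-5, 5-6,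
-- 6-7, 7-8, 2-4.  Row i lists B(α_{i+1}, α_{j+1}).
cartan : Vec (Vec ℤ 8) 8
cartan =
  (+ 2 ∷ + 0 ∷ - + 1 ∷ + 0 ∷ + 0 ∷ + 0 ∷ + 0 ∷ + 0 ∷ []) ∷
  (+ 0 ∷ + 2 ∷ + 0 ∷ - + 1 ∷ + 0 ∷ + 0 ∷ + 0 ∷ + 0 ∷ []) ∷
  (- + 1 ∷ + 0 ∷ + 2 ∷ - + 1 ∷ + 0 ∷ + 0 ∷ + 0 ∷ + 0 ∷ []) ∷
  (+ 0 ∷ - + 1 ∷ - + 1 ∷ + 2 ∷ - + 1 ∷ + 0 ∷ + 0 ∷ + 0 ∷ []) ∷
  (+ 0 ∷ + 0 ∷ + 0 ∷ - + 1 ∷ + 2 ∷ - + 1 ∷ + 0 ∷ + 0 ∷ []) ∷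
  (+ 0 ∷ + 0 ∷ + 0 ∷ + 0 ∷ - + 1 ∷ + 2 ∷ - + 1 ∷ + 0 ∷ []) ∷
  (+ 0 ∷ + 0 ∷ + 0 ∷ + 0 ∷ + 0 ∷ - + 1 ∷ + 2 ∷ - + 1 ∷ []) ∷
  (+ 0 ∷ + 0 ∷ + 0 ∷ + 0 ∷ + 0 ∷ + 0 ∷ - + 1 ∷ + 2 ∷ []) ∷
  []

sumV : ∀ {n} → Vec ℤ n → ℤ
sumV = foldr _ _+_ (+ 0)

dot : ∀ {n} → Vec ℤ n → Vec ℤ n → ℤ
dot u v = sumV (zipWith _*_ u v)

B : Vect → Vect → ℤ
B u v = dot u (map (λ row → dot row v) cartan)

_-ᵥ_ : Vect → Vect → Vect
u -ᵥ v = zipWith _-_ u v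

_·ᵥ_ : ℤ → Vect → Vect
c ·ᵥ v = map (c *_) v

s : Vect → Vect → Vect
s β γ = γ -ᵥ (B β γ ·ᵥ β)

α : Fin 8 → Vect
α i = tabulate (δ i)
  where
  δ : ∀ {n} → Fin n → Fin n → ℤ
  δ zero zero = + 1
  δ zero (suc _) = + 0
  δ (suc _) zero = + 0
  δ (suc i) (suc j) = δ i j

-- The root system Φ of E8: the orbit of the simple roots under the Weyl
-- group (generated by the simple reflections).
data IsRoot : Vect → Set where
  simple : ∀ i → IsRoot (α i)
  reflect : ∀ i {v} → IsRoot v → IsRoot (s (α i) v)

IsPosRoot : Vect → Set
IsPosRoot v = IsRoot v × All (λ c → + 0 ≤ℤ c) v

α₈ : Vect
α₈ = + 0 ∷ + 0 ∷ + 0 ∷ + 0 ∷ + 0 ∷ + 0 ∷ + 0 ∷ + 1 ∷ []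

θ : Vect
θ = + 2 ∷ + 3 ∷ + 4 ∷ + 6 ∷ + 5 ∷ + 4 ∷ + 3 ∷ + 2 ∷ []

η : Vect
η = θ -ᵥ α₈

height8 : Vect → ℤ
height8 v = lookup v (suc (suc (suc (suc (suc (suc (suc zero)))))))

InU : Vect → Set
InU v = IsPosRoot v × height8 v ≡ + 1

-- finite subsets of U represented by duplicate-free lists
IsSubsetU : List Vect → Set
IsSubsetU Q = Unique Q × (∀ {v} → v ∈ Q → InU v)

PairwiseOrth : List Vect → Set
PairwiseOrth Q = ∀ {u v} → u ∈ Q → v ∈ Q → u ≢ v → B u v ≡ + 0

OrthSubsetU : List Vect → Set
OrthSubsetU Q = IsSubsetU Q × PairwiseOrth Q

InΩU : List Vect → Set
InΩU Q = OrthSubsetU Q × (∀ Q' → OrthSubsetU Q' → length Q' ≤ length Q)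

InRes : List Vect → Vect → Set
InRes Q γ = InU γ × (∀ {β} → β ∈ Q → IsPosRoot (s β γ))

{-# OPTIONS --safe #-}
module Submission where

-- Writing v₇, v₈ for the α₇- and α₈-coefficients of v, one has B(v, η) = v₇ − v₈ and
-- B(v, α₈) = 2v₈ − v₇.
-- (i) Since {η, α₇ + α₈} is orthogonal, a maximal Q contains some β ≠ η. Then β₈ = 1 and
-- B(β, η) = 0 force β₇ = 1, so s_β(α₈) = α₈ − β has α₇-coefficient −1.
-- (ii) If γ ∈ Res_U(Q), then γ ≠ α₈ by (i), and s_η(γ) = γ − (γ₇ − 1)η has α₇- and
-- α₈-coefficients 3 − 2γ₇ and 2 − γ₇, so γ₇ ∈ {0, 1}. As α₈ is the only positive root with
-- α₈-coefficient 1 and α₇-coefficient 0 (the support of a root is connected), γ₇ = 1 and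
-- B(γ, η) = 0. That last fact is checked on the list of all 240 roots, which contains Φ
-- because it contains the simple roots and is closed under the simple reflections.

open import Defs
open import Data.Empty using (⊥-elim)
open import Data.Fin using (Fin)
open import Data.Fin.Patterns
import Data.Fin.Properties as Fin
open import Data.Integer
  using (ℤ; +_; -[1+_]; -_; _+_; _-_; _*_; _≤_) renaming (_≟_ to _≟ℤ_; _≤?_ to _≤ℤ?_)
open import Data.Integer.Properties using (+-identityˡ; *-zeroʳ; i-j≡0⇒i≡j)
open import Data.Integer.Tactic.RingSolver using (solve-∀)
open import Data.List using (List; _∷_; []; _++_; length)
import Data.List as List
open import Data.List.Membership.Propositional using (_∈_)
open import Data.List.Relation.Unary.All as All using (All; []; _∷_; all?)
open import Data.List.Relation.Unary.AllPairs using ([]; _∷_)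
open import Data.List.Relation.Unary.Any using (here; there)
open import Data.List.Relation.Unary.Linked using (Linked; [-]; _∷_; linked?)
open import Data.List.Relation.Unary.Unique.Propositional using (Unique)
open import Data.Nat using (ℕ; suc; s≤s) renaming (_≤_ to _≤ℕ_)
open import Data.Product using (_×_; _,_; proj₂; ∃-syntax)
open import Data.Sum using (_⊎_; inj₁; inj₂)
open import Data.Vec using (Vec; []; _∷_; lookup; zipWith; replicate)
import Data.Vec as Vec
import Data.Vec.Relation.Unary.All as VecAll
open import Data.Vec.Relation.Unary.All.Properties using (lookup⁺)
open import Data.Vec.Properties using (≡-dec)
open import Relation.Binary using (DecidableEquality)
open import Relation.Binary.PropositionalEquality
  using (_≡_; _≢_; refl; sym; trans; cong; cong₂; subst; module ≡-Reasoning)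
open import Relation.Nullary using (¬_; Dec; yes; no)
open import Relation.Nullary.Decidable using (from-yes; _→-dec_)

open ≡-Reasoning

_≟ᵥ_ : DecidableEquality Vect
_≟ᵥ_ = ≡-dec _≟ℤ_

open import Data.List.Membership.DecPropositional _≟ᵥ_ using (_∈?_)

Nonnegative : Vect → Set
Nonnegative = VecAll.All (+ 0 ≤_)

height7 : Vect → ℤ
height7 v = lookup v 6F

module _ {A : Set} (_≟_ : DecidableEquality A) where

  ∃-≢ : ∀ {xs : List A} → Unique xs → 2 ≤ℕ length xs → ∀ x → ∃[ y ] y ∈ xs × y ≢ x
  ∃-≢ {[]} _ () _
  ∃-≢ {_ ∷ []} _ (s≤s ()) _
  ∃-≢ {y ∷ z ∷ _} ((y≢z ∷ _) ∷ _) _ x with y ≟ x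
  ... | yes refl = z , there (here refl) , λ z≡x → y≢z (sym z≡x)
  ... | no y≢x   = y , here refl , y≢x

_ᵀ*_ : ∀ {m n} → Vec ℤ m → Vec (Vec ℤ n) m → Vec ℤ n
[] ᵀ* [] = replicate _ (+ 0)
(x ∷ u) ᵀ* (r ∷ M) = zipWith _+_ (Vec.map (x *_) r) (u ᵀ* M)

dot-replicate-0 : ∀ {n} (v : Vec ℤ n) → dot (replicate n (+ 0)) v ≡ + 0
dot-replicate-0 [] = refl
dot-replicate-0 (x ∷ v) = trans (+-identityˡ _) (dot-replicate-0 v)

dot-zipWith-+ : ∀ {n} (a b v : Vec ℤ n) → dot (zipWith _+_ a b) v ≡ dot a v + dot b v
dot-zipWith-+ [] [] [] = refl
dot-zipWith-+ (a ∷ as) (b ∷ bs) (x ∷ xs) =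
  trans (cong (_+_ ((a + b) * x)) (dot-zipWith-+ as bs xs)) (regroup a b x (dot as xs) (dot bs xs))
  where
  regroup : ∀ a b x p q → (a + b) * x + (p + q) ≡ (a * x + p) + (b * x + q)
  regroup = solve-∀

dot-map-* : ∀ {n} c (a v : Vec ℤ n) → dot (Vec.map (c *_) a) v ≡ c * dot a v
dot-map-* c [] [] = sym (*-zeroʳ c)
dot-map-* c (a ∷ as) (x ∷ xs) =
  trans (cong (_+_ (c * a * x)) (dot-map-* c as xs)) (regroup c a x (dot as xs))
  where
  regroup : ∀ c a x p → c * a * x + c * p ≡ c * (a * x + p)
  regroup = solve-∀

dot-ᵀ* : ∀ {m n} (u : Vec ℤ m) (M : Vec (Vec ℤ n) m) v →
         dot u (Vec.map (λ row → dot row v) M) ≡ dot (u ᵀ* M) v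
dot-ᵀ* [] [] v = sym (dot-replicate-0 v)
dot-ᵀ* (x ∷ u) (r ∷ M) v = begin
  x * dot r v + dot u (Vec.map (λ row → dot row v) M)  ≡⟨ cong (_+_ (x * dot r v)) (dot-ᵀ* u M v) ⟩
  x * dot r v + dot (u ᵀ* M) v                        ≡⟨ cong (_+ dot (u ᵀ* M) v) (dot-map-* x r v) ⟨
  dot (Vec.map (x *_) r) v + dot (u ᵀ* M) v          ≡⟨ dot-zipWith-+ (Vec.map (x *_) r) (u ᵀ* M) v ⟨
  dot ((x ∷ u) ᵀ* (r ∷ M)) v                          ∎

B-ηʳ : ∀ v → B v η ≡ height7 v - height8 v
B-ηʳ (a ∷ b ∷ c ∷ d ∷ e ∷ f ∷ g ∷ h ∷ []) = expand a b c d e f g h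
  where
  expand : ∀ a b c d e f g h →
    a * + 0 + (b * + 0 + (c * + 0 + (d * + 0 + (e * + 0 + (f * + 0 + (g * + 1 + (h * - + 1 + + 0)))))))
    ≡ g - h
  expand = solve-∀

B-ηˡ : ∀ v → B η v ≡ height7 v - height8 v
B-ηˡ v@(a ∷ b ∷ c ∷ d ∷ e ∷ f ∷ g ∷ h ∷ []) =
  trans (dot-ᵀ* η cartan v) (expand a b c d e f g h)
  where
  expand : ∀ a b c d e f g h →
    + 0 * a + (+ 0 * b + (+ 0 * c + (+ 0 * d + (+ 0 * e + (+ 0 * f + (+ 1 * g + (- + 1 * h + + 0)))))))
    ≡ g - h
  expand = solve-∀

B-α₈ʳ : ∀ v → B v α₈ ≡ + 2 * height8 v - height7 v
B-α₈ʳ (a ∷ b ∷ c ∷ d ∷ e ∷ f ∷ g ∷ h ∷ []) = expand a b c d e f g h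
  where
  expand : ∀ a b c d e f g h →
    a * + 0 + (b * + 0 + (c * + 0 + (d * + 0 + (e * + 0 + (f * + 0 + (g * - + 1 + (h * + 2 + + 0)))))))
    ≡ + 2 * h - g
  expand = solve-∀

nonnegative? : ∀ v → Dec (Nonnegative v)
nonnegative? = VecAll.all? (+ 0 ≤ℤ?_)

height7-s-α₈ : ∀ β → height8 β ≡ + 1 → B β η ≡ + 0 → height7 (s β α₈) ≡ - + 1
height7-s-α₈ β@(a ∷ b ∷ c ∷ d ∷ e ∷ f ∷ g ∷ h ∷ []) refl β⊥η
  with i-j≡0⇒i≡j g (+ 1) (trans (sym (B-ηʳ β)) β⊥η)
... | refl = cong (λ k → + 0 - k * + 1) (B-α₈ʳ β)

s-α₈-not-nonnegative : ∀ β → height8 β ≡ + 1 → B β η ≡ + 0 → ¬ Nonnegative (s β α₈)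
s-α₈-not-nonnegative β β₈≡1 β⊥η s≥0
  with subst (+ 0 ≤_) (height7-s-α₈ β β₈≡1 β⊥η) (lookup⁺ s≥0 6F)
... | ()

height7≡0⊎1 : ∀ γ → height8 γ ≡ + 1 → Nonnegative γ → Nonnegative (s η γ) →
              height7 γ ≡ + 0 ⊎ height7 γ ≡ + 1
height7≡0⊎1 γ@(a ∷ b ∷ c ∷ d ∷ e ∷ f ∷ g ∷ h ∷ []) refl γ≥0 sγ≥0 =
  zero-or-one g (lookup⁺ γ≥0 6F)
    (subst (λ k → + 0 ≤ g - k * + 3) (B-ηˡ γ) (lookup⁺ sγ≥0 6F))
    (subst (λ k → + 0 ≤ + 1 - k * + 1) (B-ηˡ γ) (lookup⁺ sγ≥0 7F))
  where
  zero-or-one : ∀ x → + 0 ≤ x → + 0 ≤ x - (x - + 1) * + 3 → + 0 ≤ + 1 - (x - + 1) * + 1 →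
                x ≡ + 0 ⊎ x ≡ + 1
  zero-or-one (+ 0) _ _ _ = inj₁ refl
  zero-or-one (+ 1) _ _ _ = inj₂ refl
  zero-or-one (+ 2) _ () _
  zero-or-one (+ suc (suc (suc n))) _ _ ()
  zero-or-one -[1+ n ] () _ _

SimpleReflection : Vect → Vect → Set
SimpleReflection v u = ∃[ i ] s (α i) v ≡ u

simpleReflection? : ∀ v u → Dec (SimpleReflection v u)
simpleReflection? v u = Fin.any? λ i → s (α i) v ≟ᵥ u

IsRoot-linked : ∀ {v vs} → IsRoot v → Linked SimpleReflection (v ∷ vs) → All IsRoot (v ∷ vs)
IsRoot-linked r [-]              = r ∷ []
IsRoot-linked r ((i , refl) ∷ l) = r ∷ IsRoot-linked (reflect i r) l

IsRoot⇒∈ : ∀ {R} → (∀ i → α i ∈ R) → (∀ i → All (λ v → s (α i) v ∈ R) R) →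
           ∀ {v} → IsRoot v → v ∈ R
IsRoot⇒∈ simple∈R R-closed (simple i)    = simple∈R i
IsRoot⇒∈ simple∈R R-closed (reflect i r) = All.lookup (R-closed i) (IsRoot⇒∈ simple∈R R-closed r)

root : ℕ → ℕ → ℕ → ℕ → ℕ → ℕ → ℕ → ℕ → Vect
root a b c d e f g h = + a ∷ + b ∷ + c ∷ + d ∷ + e ∷ + f ∷ + g ∷ + h ∷ []

positiveRoots : List Vect
positiveRoots =
  root 1 0 0 0 0 0 0 0 ∷ root 0 1 0 0 0 0 0 0 ∷ root 0 0 1 0 0 0 0 0 ∷ root 0 0 0 1 0 0 0 0 ∷
  root 0 0 0 0 1 0 0 0 ∷ root 0 0 0 0 0 1 0 0 ∷ root 0 0 0 0 0 0 1 0 ∷ root 0 0 0 0 0 0 0 1 ∷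
  root 1 0 1 0 0 0 0 0 ∷ root 0 1 0 1 0 0 0 0 ∷ root 0 0 1 1 0 0 0 0 ∷ root 0 0 0 1 1 0 0 0 ∷
  root 0 0 0 0 1 1 0 0 ∷ root 0 0 0 0 0 1 1 0 ∷ root 0 0 0 0 0 0 1 1 ∷
  root 1 0 1 1 0 0 0 0 ∷ root 0 1 1 1 0 0 0 0 ∷ root 0 1 0 1 1 0 0 0 ∷ root 0 0 1 1 1 0 0 0 ∷
  root 0 0 0 1 1 1 0 0 ∷ root 0 0 0 0 1 1 1 0 ∷ root 0 0 0 0 0 1 1 1 ∷
  root 1 1 1 1 0 0 0 0 ∷ root 1 0 1 1 1 0 0 0 ∷ root 0 1 1 1 1 0 0 0 ∷ root 0 1 0 1 1 1 0 0 ∷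
  root 0 0 1 1 1 1 0 0 ∷ root 0 0 0 1 1 1 1 0 ∷ root 0 0 0 0 1 1 1 1 ∷
  root 1 1 1 1 1 0 0 0 ∷ root 0 1 1 2 1 0 0 0 ∷ root 1 0 1 1 1 1 0 0 ∷ root 0 1 1 1 1 1 0 0 ∷
  root 0 1 0 1 1 1 1 0 ∷ root 0 0 1 1 1 1 1 0 ∷ root 0 0 0 1 1 1 1 1 ∷
  root 1 1 1 2 1 0 0 0 ∷ root 1 1 1 1 1 1 0 0 ∷ root 0 1 1 2 1 1 0 0 ∷ root 1 0 1 1 1 1 1 0 ∷
  root 0 1 1 1 1 1 1 0 ∷ root 0 1 0 1 1 1 1 1 ∷ root 0 0 1 1 1 1 1 1 ∷
  root 1 1 2 2 1 0 0 0 ∷ root 1 1 1 2 1 1 0 0 ∷ root 0 1 1 2 2 1 0 0 ∷ root 1 1 1 1 1 1 1 0 ∷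
  root 0 1 1 2 1 1 1 0 ∷ root 1 0 1 1 1 1 1 1 ∷ root 0 1 1 1 1 1 1 1 ∷
  root 1 1 2 2 1 1 0 0 ∷ root 1 1 1 2 2 1 0 0 ∷ root 1 1 1 2 1 1 1 0 ∷ root 0 1 1 2 2 1 1 0 ∷
  root 1 1 1 1 1 1 1 1 ∷ root 0 1 1 2 1 1 1 1 ∷
  root 1 1 2 2 2 1 0 0 ∷ root 1 1 2 2 1 1 1 0 ∷ root 1 1 1 2 2 1 1 0 ∷ root 0 1 1 2 2 2 1 0 ∷
  root 1 1 1 2 1 1 1 1 ∷ root 0 1 1 2 2 1 1 1 ∷
  root 1 1 2 3 2 1 0 0 ∷ root 1 1 2 2 2 1 1 0 ∷ root 1 1 1 2 2 2 1 0 ∷ root 1 1 2 2 1 1 1 1 ∷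
  root 1 1 1 2 2 1 1 1 ∷ root 0 1 1 2 2 2 1 1 ∷
  root 1 2 2 3 2 1 0 0 ∷ root 1 1 2 3 2 1 1 0 ∷ root 1 1 2 2 2 2 1 0 ∷ root 1 1 2 2 2 1 1 1 ∷
  root 1 1 1 2 2 2 1 1 ∷ root 0 1 1 2 2 2 2 1 ∷
  root 1 2 2 3 2 1 1 0 ∷ root 1 1 2 3 2 2 1 0 ∷ root 1 1 2 3 2 1 1 1 ∷ root 1 1 2 2 2 2 1 1 ∷
  root 1 1 1 2 2 2 2 1 ∷
  root 1 2 2 3 2 2 1 0 ∷ root 1 1 2 3 3 2 1 0 ∷ root 1 2 2 3 2 1 1 1 ∷ root 1 1 2 3 2 2 1 1 ∷
  root 1 1 2 2 2 2 2 1 ∷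
  root 1 2 2 3 3 2 1 0 ∷ root 1 2 2 3 2 2 1 1 ∷ root 1 1 2 3 3 2 1 1 ∷ root 1 1 2 3 2 2 2 1 ∷
  root 1 2 2 4 3 2 1 0 ∷ root 1 2 2 3 3 2 1 1 ∷ root 1 2 2 3 2 2 2 1 ∷ root 1 1 2 3 3 2 2 1 ∷
  root 1 2 3 4 3 2 1 0 ∷ root 1 2 2 4 3 2 1 1 ∷ root 1 2 2 3 3 2 2 1 ∷ root 1 1 2 3 3 3 2 1 ∷
  root 2 2 3 4 3 2 1 0 ∷ root 1 2 3 4 3 2 1 1 ∷ root 1 2 2 4 3 2 2 1 ∷ root 1 2 2 3 3 3 2 1 ∷
  root 2 2 3 4 3 2 1 1 ∷ root 1 2 3 4 3 2 2 1 ∷ root 1 2 2 4 3 3 2 1 ∷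
  root 2 2 3 4 3 2 2 1 ∷ root 1 2 3 4 3 3 2 1 ∷ root 1 2 2 4 4 3 2 1 ∷
  root 2 2 3 4 3 3 2 1 ∷ root 1 2 3 4 4 3 2 1 ∷
  root 2 2 3 4 4 3 2 1 ∷ root 1 2 3 5 4 3 2 1 ∷
  root 2 2 3 5 4 3 2 1 ∷ root 1 3 3 5 4 3 2 1 ∷
  root 2 3 3 5 4 3 2 1 ∷ root 2 2 4 5 4 3 2 1 ∷
  root 2 3 4 5 4 3 2 1 ∷
  root 2 3 4 6 4 3 2 1 ∷
  root 2 3 4 6 5 3 2 1 ∷
  root 2 3 4 6 5 4 2 1 ∷
  root 2 3 4 6 5 4 3 1 ∷
  root 2 3 4 6 5 4 3 2 ∷ []

roots : List Vect
roots = positiveRoots ++ List.map (Vec.map (λ c → - c)) positiveRoots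

s-closed? : ∀ i → Dec (All (λ v → s (α i) v ∈ roots) roots)
s-closed? i = all? (λ v → s (α i) v ∈? roots) roots

-- One clause per simple root: deciding all eight at once exhausts memory.
roots-closed : ∀ i → All (λ v → s (α i) v ∈ roots) roots
roots-closed 0F = from-yes (s-closed? 0F)
roots-closed 1F = from-yes (s-closed? 1F)
roots-closed 2F = from-yes (s-closed? 2F)
roots-closed 3F = from-yes (s-closed? 3F)
roots-closed 4F = from-yes (s-closed? 4F)
roots-closed 5F = from-yes (s-closed? 5F)
roots-closed 6F = from-yes (s-closed? 6F)
roots-closed 7F = from-yes (s-closed? 7F)

roots-complete : ∀ {v} → IsRoot v → v ∈ roots
roots-complete = IsRoot⇒∈ (from-yes (Fin.all? λ i → α i ∈? roots)) roots-closed

positive-root-off-α₇ : ∀ {γ} → IsPosRoot γ → height8 γ ≡ + 1 → height7 γ ≡ + 0 → γ ≡ α₈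
positive-root-off-α₇ (γ-root , γ≥0) = All.lookup checked (roots-complete γ-root) γ≥0
  where
  checked : All (λ γ → Nonnegative γ → height8 γ ≡ + 1 → height7 γ ≡ + 0 → γ ≡ α₈) roots
  checked = from-yes (all? (λ γ → nonnegative? γ →-dec height8 γ ≟ℤ + 1 →-dec
                                  height7 γ ≟ℤ + 0 →-dec γ ≟ᵥ α₈) roots)

s-η-nonnegative⇒⊥η : ∀ {γ} → InU γ → γ ≢ α₈ → Nonnegative (s η γ) → B γ η ≡ + 0
s-η-nonnegative⇒⊥η {γ} ((γ-root , γ≥0) , γ₈≡1) γ≢α₈ sγ≥0 with height7≡0⊎1 γ γ₈≡1 γ≥0 sγ≥0
... | inj₁ γ₇≡0 = ⊥-elim (γ≢α₈ (positive-root-off-α₇ (γ-root , γ≥0) γ₈≡1 γ₇≡0))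
... | inj₂ γ₇≡1 = begin
  B γ η                    ≡⟨ B-ηʳ γ ⟩
  height7 γ - height8 γ    ≡⟨ cong₂ _-_ γ₇≡1 γ₈≡1 ⟩
  + 1 - + 1                ≡⟨⟩
  + 0                      ∎

η-root : IsRoot η
η-root = All.lookup (IsRoot-linked (simple 0F) (from-yes (linked? simpleReflection? ascent)))
                    (from-yes (η ∈? ascent))
  where
  ascent : List Vect
  ascent =
    root 1 0 0 0 0 0 0 0 ∷ root 1 0 1 0 0 0 0 0 ∷ root 1 0 1 1 0 0 0 0 ∷ root 1 1 1 1 0 0 0 0 ∷
    root 1 1 1 1 1 0 0 0 ∷ root 1 1 1 2 1 0 0 0 ∷ root 1 1 2 2 1 0 0 0 ∷ root 1 1 2 2 1 1 0 0 ∷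
    root 1 1 2 2 2 1 0 0 ∷ root 1 1 2 3 2 1 0 0 ∷ root 1 2 2 3 2 1 0 0 ∷ root 1 2 2 3 2 1 1 0 ∷
    root 1 2 2 3 2 2 1 0 ∷ root 1 2 2 3 3 2 1 0 ∷ root 1 2 2 4 3 2 1 0 ∷ root 1 2 3 4 3 2 1 0 ∷
    root 2 2 3 4 3 2 1 0 ∷ root 2 2 3 4 3 2 1 1 ∷ root 2 2 3 4 3 2 2 1 ∷ root 2 2 3 4 3 3 2 1 ∷
    root 2 2 3 4 4 3 2 1 ∷ root 2 2 3 5 4 3 2 1 ∷ root 2 3 3 5 4 3 2 1 ∷ root 2 3 4 5 4 3 2 1 ∷
    root 2 3 4 6 4 3 2 1 ∷ root 2 3 4 6 5 3 2 1 ∷ root 2 3 4 6 5 4 2 1 ∷ η ∷ []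


α₇+α₈ : Vect
α₇+α₈ = root 0 0 0 0 0 0 1 1

orthogonal-pair : OrthSubsetU (η ∷ α₇+α₈ ∷ [])
orthogonal-pair = ((((λ ()) ∷ []) ∷ [] ∷ []) , ⊆U) , orthogonal
  where
  ⊆U : ∀ {v} → v ∈ η ∷ α₇+α₈ ∷ [] → InU v
  ⊆U (here refl)         = (η-root , from-yes (nonnegative? η)) , refl
  ⊆U (there (here refl)) = (reflect 6F (simple 7F) , from-yes (nonnegative? α₇+α₈)) , refl
  orthogonal : PairwiseOrth (η ∷ α₇+α₈ ∷ [])
  orthogonal (here refl)         (here refl)         η≢η = ⊥-elim (η≢η refl)
  orthogonal (here refl)         (there (here refl)) _   = refl
  orthogonal (there (here refl)) (here refl)         _   = refl
  orthogonal (there (here refl)) (there (here refl)) u≢u = ⊥-elim (u≢u refl)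

lemma5p11 : ∀ (Q : List Vect) → InΩU Q → η ∈ Q →
    (¬ InRes Q α₈) × (∀ γ → InRes Q γ → B γ η ≡ + 0)
lemma5p11 Q (((Q-unique , Q⊆U) , Q-orthogonal) , Q-maximal) η∈Q = α₈∉Res , Res⊥η
  where
  α₈∉Res : ¬ InRes Q α₈
  α₈∉Res (_ , s-positive) =
    let β , β∈Q , β≢η = ∃-≢ _≟ᵥ_ Q-unique (Q-maximal _ orthogonal-pair) η
    in  s-α₈-not-nonnegative β (proj₂ (Q⊆U β∈Q)) (Q-orthogonal β∈Q η∈Q β≢η)
          (proj₂ (s-positive β∈Q))
  Res⊥η : ∀ γ → InRes Q γ → B γ η ≡ + 0
  Res⊥η γ γ∈Res@(γ∈U , s-positive) =
    s-η-nonnegative⇒⊥η γ∈U (λ { refl → α₈∉Res γ∈Res }) (proj₂ (s-positive η∈Q))
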